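{- Let $R$ be a commutative ring, $a,a'\in R$, $p\ge1$, and let $D(K_p;a,a')$ be the $p\times p$ matrix with $(i,j)$ entry $a$ if $i<j$, $0$ if $i=j$, $a'$ if $i>j$. For $r\ge-1$ write $h_r=\frac{a^{r+1}-(a')^{r+1}}{a-a'}:=\sum_{s=0}^{r}a^s(a')^{r-s}$ (so $h_{ -1}=0$). Then $$\det D(K_p;a,a')=(-1)^{p-1}aa'h_{p-2},\qquad \operatorname{cof}D(K_p;a,a')=(-1)^{p-1}h_{p-1},$$ and for $p\ge2$ the adjugate $\operatorname{adj}D(K_p;a,a')$ is the Toeplitz matrix with entries: $(-1)^{p-1}\alpha$ on the diagonal, where $\alpha=-aa'h_{p-3}$; $(-1)^{p-1}(a')^{i-j}a^{p-1-(i-j)}$ in position $(i,j)$ for $i>j$; and $(-1)^{p-1}(a')^{p-1-(j-i)}a^{j-i}$ in position $(i,j)$ for $i<j$. For $p=1$, $\operatorname{adj}D(K_1;a,a')=\operatorname{cof}D(K_1;a,a')=1$.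
   Context: $\operatorname{cof}(A)$ is the sum of all cofactors of $A$, and $\operatorname{adj}(A)$ is the adjugate, with $(i,j)$ entry the $(j,i)$ cofactor $(-1)^{i+j}\det A_{(j,i)}$. -}

module Defs where

open import Level using (Level)
open import Data.Nat using (ℕ; zero; suc)
import Data.Nat as ℕ
open import Relation.Nullary using (yes; no)
import Data.Fin as Fin
open import Data.Fin using (Fin; zero; suc; toℕ; punchIn; _<?_)
open import Algebra.Bundles using (CommutativeRing)

module Det {c ℓ : Level} (R : CommutativeRing c ℓ) where
  open CommutativeRing R

  Matrix : ℕ → Set c
  Matrix n = Fin n → Fin n → Carrier

  ∑ : ∀ {n} → (Fin n → Carrier) → Carrier
  ∑ {zero}  f = 0#
  ∑ {suc n} f = f Fin.zero + ∑ (λ i → f (suc i))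

  _^_ : Carrier → ℕ → Carrier
  x ^ zero  = 1#
  x ^ suc k = x * (x ^ k)

  sgn : ℕ → Carrier
  sgn zero    = 1#
  sgn (suc k) = - sgn k

  minor : ∀ {n} → Fin (suc n) → Fin (suc n) → Matrix (suc n) → Matrix n
  minor i j M k l = M (punchIn i k) (punchIn j l)

  det : ∀ {n} → Matrix n → Carrier
  det {zero}  M = 1#
  det {suc n} M = ∑ (λ j → sgn (toℕ j) * (M Fin.zero j * det (minor Fin.zero j M)))

  cofactor : ∀ {n} → Matrix (suc n) → Fin (suc n) → Fin (suc n) → Carrier
  cofactor M i j = sgn (toℕ i ℕ.+ toℕ j) * det (minor i j M)

  adj : ∀ {n} → Matrix (suc n) → Matrix (suc n)
  adj M i j = cofactor M j i

  cof : ∀ {n} → Matrix (suc n) → Carrier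
  cof M = ∑ (λ i → ∑ (λ j → cofactor M i j))

  DK : (p : ℕ) → Carrier → Carrier → Matrix p
  DK p a a' i j with i <? j | j <? i
  ... | yes _ | _     = a
  ... | no _  | yes _ = a'
  ... | no _  | no _  = 0#

  -- H a a' k = h_{k-1} = ∑_{s=0}^{k-1} a^s a'^{k-1-s}   (so H a a' 0 = h_{-1} = 0)
  H : Carrier → Carrier → ℕ → Carrier
  H a a' k = ∑ {k} (λ s → (a ^ toℕ s) * (a' ^ (k ℕ.∸ 1 ℕ.∸ toℕ s)))

-- Everything about
-- K = D(K_p; a, a') then comes from row operations.  Row 0 of K is row 1 plus -a' e₀ + a e₁, so
-- D_{p+2} + a' D_{p+1} = -a (D_{p+1} + a' D_p), and symmetrically with a and a' exchanged; these
-- first-order recurrences give det K and the cofactors next to the diagonal.  A minor further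
-- from the diagonal has two adjacent rows differing by a' (or a) times a unit vector, so each step
-- away from the diagonal contributes one factor a' (or a).  Finally cof K = ∑ᵢ det (K with row i
-- replaced by ones); for i > 0, subtracting a times the row of ones from row 0 shows that this
-- determinant is -a times the one of size p - 1, which yields h_k = a'^k + a h_{k-1}.

module Submission where

open import Defs
open import Level using (Level)
open import Data.Nat using (ℕ; zero; suc; _∸_; s≤s)
import Data.Nat as ℕ
import Data.Nat.Properties as ℕₚ
open import Data.Bool using (if_then_else_)
open import Data.Fin using (Fin; zero; suc; toℕ; punchIn; punchOut; _<_)
import Data.Fin as Fin
import Data.Fin.Properties as Finₚ
open import Data.Product using (Σ; _×_; _,_; proj₁; proj₂)
open import Data.Empty using (⊥-elim)
open import Data.Vec.Functional using (updateAt)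
open import Data.Vec.Functional.Properties using (updateAt-updates; updateAt-minimal)
open import Function using (_∘_; const)
open import Relation.Binary.PropositionalEquality as ≡ using (_≡_; _≢_)
open import Relation.Nullary using (yes; no)
open import Algebra.Bundles using (CommutativeRing)
import Algebra.Properties.Ring as RingProperties
import Algebra.Solver.Ring.NaturalCoefficients.Default as NaturalCoefficientSolver
import Relation.Binary.Reasoning.Setoid as SetoidReasoning

punchInℕ : ℕ → ℕ → ℕ
punchInℕ zero    x       = suc x
punchInℕ (suc i) zero    = zero
punchInℕ (suc i) (suc x) = suc (punchInℕ i x)

toℕ-punchIn : ∀ {n} (i : Fin (suc n)) (k : Fin n) → toℕ (punchIn i k) ≡ punchInℕ (toℕ i) (toℕ k)
toℕ-punchIn zero    k       = ≡.refl
toℕ-punchIn (suc i) zero    = ≡.refl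
toℕ-punchIn (suc i) (suc k) = ≡.cong suc (toℕ-punchIn i k)

punchInℕ-< : ∀ {i x} → x ℕ.< i → punchInℕ i x ≡ x
punchInℕ-< {suc i} {zero}  _         = ≡.refl
punchInℕ-< {suc i} {suc x} (s≤s x<i) = ≡.cong suc (punchInℕ-< x<i)

punchInℕ-≥ : ∀ {i x} → i ℕ.≤ x → punchInℕ i x ≡ suc x
punchInℕ-≥ {zero}  _         = ≡.refl
punchInℕ-≥ {suc i} {suc x} (s≤s i≤x) = ≡.cong suc (punchInℕ-≥ i≤x)

punchInℕ-punchInℕ : ∀ i j x → i ℕ.≤ j → punchInℕ i (punchInℕ j x) ≡ punchInℕ (suc j) (punchInℕ i x)
punchInℕ-punchInℕ zero    j       x       _         = ≡.refl
punchInℕ-punchInℕ (suc i) (suc j) zero    _         = ≡.refl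
punchInℕ-punchInℕ (suc i) (suc j) (suc x) (s≤s i≤j) = ≡.cong suc (punchInℕ-punchInℕ i j x i≤j)

-- Both sides enumerate Fin (2 + n) without the two indices j and j'.
punchIn-punchIn-swap : ∀ {n} (j j' : Fin (suc (suc n))) (k k' : Fin (suc n)) →
                       j' ≡ punchIn j k → punchIn j' k' ≡ j →
                       ∀ y → punchIn j (punchIn k y) ≡ punchIn j' (punchIn k' y)
punchIn-punchIn-swap zero    _ k       zero     ≡.refl ≡.refl y = ≡.refl
punchIn-punchIn-swap (suc j) _ zero    _        ≡.refl ≡.refl y = ≡.refl
punchIn-punchIn-swap {suc n} (suc j) _ (suc k) (suc k') ≡.refl e zero    = ≡.refl
punchIn-punchIn-swap {suc n} (suc j) _ (suc k) (suc k') ≡.refl e (suc y) =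
  ≡.cong suc (punchIn-punchIn-swap j (punchIn j k) k k' ≡.refl (Finₚ.suc-injective e) y)

module Determinant {c ℓ : Level} (R : CommutativeRing c ℓ) where
  open CommutativeRing R hiding (zero)
  open Det R
  open RingProperties ring
  open SetoidReasoning setoid
  open NaturalCoefficientSolver commutativeSemiring using (solve; _:=_; _:+_; _:*_; con)

  sgn-+ : ∀ m n → sgn (m ℕ.+ n) ≈ sgn m * sgn n
  sgn-+ zero    n = sym (*-identityˡ (sgn n))
  sgn-+ (suc m) n = trans (-‿cong (sgn-+ m n)) (-‿distribˡ-* (sgn m) (sgn n))

  -‿*-‿ : ∀ x y → - x * - y ≈ x * y
  -‿*-‿ x y = begin
    - x * - y    ≈⟨ -‿distribˡ-* x (- y) ⟨
    - (x * - y)  ≈⟨ -‿cong (-‿distribʳ-* x y) ⟨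
    - - (x * y)  ≈⟨ -‿involutive _ ⟩
    x * y        ∎

  sgn-*-sgn : ∀ k → sgn k * sgn k ≈ 1#
  sgn-*-sgn zero    = *-identityˡ 1#
  sgn-*-sgn (suc k) = trans (-‿*-‿ (sgn k) (sgn k)) (sgn-*-sgn k)

  sgn-double : ∀ k → sgn (k ℕ.+ k) ≈ 1#
  sgn-double k = trans (sgn-+ k k) (sgn-*-sgn k)

  sgn-∸ : ∀ {m n} → n ℕ.≤ m → sgn (m ∸ n) ≈ sgn m * sgn n
  sgn-∸ {m} {n} n≤m = begin
    sgn (m ∸ n)                    ≈⟨ *-identityʳ _ ⟨
    sgn (m ∸ n) * 1#               ≈⟨ *-congˡ (sgn-*-sgn n) ⟨
    sgn (m ∸ n) * (sgn n * sgn n)  ≈⟨ *-assoc _ _ _ ⟨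
    sgn (m ∸ n) * sgn n * sgn n    ≈⟨ *-congʳ (sgn-+ (m ∸ n) n) ⟨
    sgn (m ∸ n ℕ.+ n) * sgn n      ≡⟨ ≡.cong (λ k → sgn k * sgn n) (ℕₚ.m∸n+n≡m n≤m) ⟩
    sgn m * sgn n                  ∎

  ∑-cong : ∀ {n} {f g : Fin n → Carrier} → (∀ i → f i ≈ g i) → ∑ f ≈ ∑ g
  ∑-cong {zero}  _   = refl
  ∑-cong {suc n} f≈g = +-cong (f≈g zero) (∑-cong (f≈g ∘ suc))

  ∑-zero : ∀ {n} {f : Fin n → Carrier} → (∀ i → f i ≈ 0#) → ∑ f ≈ 0#
  ∑-zero {zero}  _    = refl
  ∑-zero {suc n} f≈0 = trans (+-cong (f≈0 zero) (∑-zero (f≈0 ∘ suc))) (+-identityˡ 0#)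

  ∑-distrib-+ : ∀ {n} (f g : Fin n → Carrier) → ∑ (λ i → f i + g i) ≈ ∑ f + ∑ g
  ∑-distrib-+ {zero}  f g = sym (+-identityˡ 0#)
  ∑-distrib-+ {suc n} f g = trans (+-congˡ (∑-distrib-+ (f ∘ suc) (g ∘ suc)))
    (solve 4 (λ x y s t → (x :+ y) :+ (s :+ t) := (x :+ s) :+ (y :+ t)) refl
       (f zero) (g zero) (∑ (f ∘ suc)) (∑ (g ∘ suc)))

  *-distribˡ-∑ : ∀ {n} x (f : Fin n → Carrier) → x * ∑ f ≈ ∑ (λ i → x * f i)
  *-distribˡ-∑ {zero}  x f = zeroʳ x
  *-distribˡ-∑ {suc n} x f = trans (distribˡ x _ _) (+-congˡ (*-distribˡ-∑ x (f ∘ suc)))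

  δℕ : ℕ → ℕ → Carrier
  δℕ j l = if l ℕ.≡ᵇ j then 1# else 0#

  δ : ∀ {n} → Fin n → Fin n → Carrier
  δ j l = δℕ (toℕ j) (toℕ l)

  ∑-δ : ∀ {n} (j : Fin n) (f : Fin n → Carrier) → ∑ (λ l → δ j l * f l) ≈ f j
  ∑-δ zero f = begin
    1# * f zero + ∑ (λ l → 0# * f (suc l))  ≈⟨ +-cong (*-identityˡ _) (∑-zero {f = λ l → 0# * f (suc l)} (λ l → zeroˡ _)) ⟩
    f zero + 0#                             ≈⟨ +-identityʳ _ ⟩
    f zero                                  ∎
  ∑-δ (suc j) f = trans (+-cong (zeroˡ _) (∑-δ j (f ∘ suc))) (+-identityˡ _)

  ∑-scaledδ : ∀ {n} y (j : Fin n) (f : Fin n → Carrier) → ∑ (λ l → (y * δ j l) * f l) ≈ y * f j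
  ∑-scaledδ y j f = begin
    ∑ (λ l → (y * δ j l) * f l)  ≈⟨ ∑-cong (λ l → *-assoc y (δ j l) (f l)) ⟩
    ∑ (λ l → y * (δ j l * f l))  ≈⟨ *-distribˡ-∑ y (λ l → δ j l * f l) ⟨
    y * ∑ (λ l → δ j l * f l)    ≈⟨ *-congˡ (∑-δ j f) ⟩
    y * f j                      ∎

  ∑-δ₂ : ∀ {n} y z (j k : Fin n) (f : Fin n → Carrier) →
         ∑ (λ l → (y * δ j l + z * δ k l) * f l) ≈ y * f j + z * f k
  ∑-δ₂ y z j k f = begin
    ∑ (λ l → (y * δ j l + z * δ k l) * f l)
      ≈⟨ ∑-cong (λ l → distribʳ (f l) _ _) ⟩
    ∑ (λ l → (y * δ j l) * f l + (z * δ k l) * f l)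
      ≈⟨ ∑-distrib-+ (λ l → (y * δ j l) * f l) (λ l → (z * δ k l) * f l) ⟩
    ∑ (λ l → (y * δ j l) * f l) + ∑ (λ l → (z * δ k l) * f l)
      ≈⟨ +-cong (∑-scaledδ y j f) (∑-scaledδ z k f) ⟩
    y * f j + z * f k ∎

  det-cong : ∀ {n} {M N : Matrix n} → (∀ i j → M i j ≈ N i j) → det M ≈ det N
  det-cong {zero}          _   = refl
  det-cong {suc n} {M} {N} M≈N = ∑-cong
    {f = λ j → sgn (toℕ j) * (M zero j * det (minor zero j M))}
    {g = λ j → sgn (toℕ j) * (N zero j * det (minor zero j N))}
    (λ j → *-congˡ (*-cong (M≈N zero j) (det-cong (λ k l → M≈N (suc k) (punchIn j l)))))

  -- toℕ l + toℕ j' and toℕ j + toℕ l' differ by exactly one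
  sgn-punchIn-pair : ∀ {n} (l j : Fin (suc n)) (j' l' : Fin n) →
                     j ≡ punchIn l j' → l ≡ punchIn j l' →
                     sgn (toℕ l) * sgn (toℕ j') ≈ - (sgn (toℕ j) * sgn (toℕ l'))
  sgn-punchIn-pair zero _ j' zero ≡.refl ≡.refl = begin
    1# * sgn (toℕ j')        ≈⟨ *-identityˡ _ ⟩
    sgn (toℕ j')             ≈⟨ -‿involutive _ ⟨
    - - sgn (toℕ j')         ≈⟨ -‿cong (*-identityʳ _) ⟨
    - (- sgn (toℕ j') * 1#)  ∎
  sgn-punchIn-pair (suc l) _ zero _ ≡.refl ≡.refl =
    trans (*-identityʳ _) (-‿cong (sym (*-identityˡ _)))
  sgn-punchIn-pair {suc n} (suc l) _ (suc j') (suc l') ≡.refl e = begin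
    - sgn (toℕ l) * - sgn (toℕ j')               ≈⟨ -‿*-‿ _ _ ⟩
    sgn (toℕ l) * sgn (toℕ j')                   ≈⟨ sgn-punchIn-pair l _ j' l' ≡.refl (Finₚ.suc-injective e) ⟩
    - (sgn (toℕ (punchIn l j')) * sgn (toℕ l'))  ≈⟨ -‿cong (-‿*-‿ _ _) ⟨
    - (- sgn (toℕ (punchIn l j')) * - sgn (toℕ l')) ∎

  -- both sides sum over the ordered pairs of distinct indices of Fin (suc n)
  ∑∑-punchIn-swap : ∀ {n} (T T' : Fin (suc n) → Fin n → Carrier) →
                    (∀ l j j' l' → j ≡ punchIn l j' → l ≡ punchIn j l' → T l j' ≈ T' j l') →
                    ∑ (λ l → ∑ (T l)) ≈ ∑ (λ j → ∑ (T' j))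
  ∑∑-punchIn-swap {zero}  T T' _ = refl
  ∑∑-punchIn-swap {suc n} T T' T≈T' = begin
    ∑ (T zero) + ∑ (λ l → T (suc l) zero + ∑ (λ j → T (suc l) (suc j)))
      ≈⟨ +-congˡ (∑-distrib-+ (λ l → T (suc l) zero) (λ l → ∑ (λ j → T (suc l) (suc j)))) ⟩
    ∑ (T zero) + (∑ (λ l → T (suc l) zero) + ∑ (λ l → ∑ (λ j → T (suc l) (suc j))))
      ≈⟨ +-cong (∑-cong (λ j' → T≈T' zero (suc j') j' zero ≡.refl ≡.refl))
                (+-cong (∑-cong (λ l → T≈T' (suc l) zero zero l ≡.refl ≡.refl))
                        (∑∑-punchIn-swap (λ l j → T (suc l) (suc j)) (λ j l → T' (suc j) (suc l))
                           (λ l j j' l' e e' → T≈T' (suc l) (suc j) (suc j') (suc l') (≡.cong suc e) (≡.cong suc e')))) ⟩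
    ∑ (λ j → T' (suc j) zero) + (∑ (T' zero) + ∑ (λ j → ∑ (λ l → T' (suc j) (suc l))))
      ≈⟨ solve 3 (λ x y z → x :+ (y :+ z) := y :+ (x :+ z)) refl _ _ _ ⟩
    ∑ (T' zero) + (∑ (λ j → T' (suc j) zero) + ∑ (λ j → ∑ (λ l → T' (suc j) (suc l))))
      ≈⟨ +-congˡ (∑-distrib-+ (λ j → T' (suc j) zero) (λ j → ∑ (λ l → T' (suc j) (suc l)))) ⟨
    ∑ (T' zero) + ∑ (λ j → T' (suc j) zero + ∑ (λ l → T' (suc j) (suc l))) ∎

  private
    *-exchange-signs : ∀ sl sj' si sj sl' m₀ mᵢ d → sl * sj' ≈ - (sj * sl') →
                       sl * (m₀ * (mᵢ * ((si * sj') * d))) ≈ mᵢ * (- (si * sj) * (sl' * (m₀ * d)))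
    *-exchange-signs sl sj' si sj sl' m₀ mᵢ d signs = begin
      sl * (m₀ * (mᵢ * ((si * sj') * d)))
        ≈⟨ solve 6 (λ sl sj' si m₀ mᵢ d → sl :* (m₀ :* (mᵢ :* ((si :* sj') :* d)))
                                         := mᵢ :* ((sl :* sj') :* (si :* (m₀ :* d)))) refl sl sj' si m₀ mᵢ d ⟩
      mᵢ * ((sl * sj') * (si * (m₀ * d)))     ≈⟨ *-congˡ (*-congʳ signs) ⟩
      mᵢ * (- (sj * sl') * (si * (m₀ * d)))   ≈⟨ *-congˡ (-‿distribˡ-* _ _) ⟨
      mᵢ * - ((sj * sl') * (si * (m₀ * d)))
        ≈⟨ *-congˡ (-‿cong (solve 4 (λ sj sl' si x → (sj :* sl') :* (si :* x) := (si :* sj) :* (sl' :* x)) refl sj sl' si _)) ⟩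
      mᵢ * - ((si * sj) * (sl' * (m₀ * d)))   ≈⟨ *-congˡ (-‿distribˡ-* _ _) ⟩
      mᵢ * (- (si * sj) * (sl' * (m₀ * d)))   ∎

  -- Expand along row 0 and each minor along row i, then regroup the double sum by the pair of columns used.
  det-expandRow : ∀ {n} (i : Fin (suc n)) (M : Matrix (suc n)) → det M ≈ ∑ (λ j → M i j * cofactor M i j)
  det-expandRow zero M = ∑-cong {f = λ j → sgn (toℕ j) * (M zero j * det (minor zero j M))}
                                {g = λ j → M zero j * cofactor M zero j} (λ j →
    solve 3 (λ s m d → s :* (m :* d) := m :* (s :* d)) refl (sgn (toℕ j)) (M zero j) (det (minor zero j M)))
  det-expandRow {suc n} (suc i) M = begin
    ∑ (λ l → sgn (toℕ l) * (M zero l * det (minor zero l M)))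
      ≈⟨ ∑-cong {f = λ l → sgn (toℕ l) * (M zero l * det (minor zero l M))}
                {g = λ l → sgn (toℕ l) * (M zero l * ∑ (inner l))}
                (λ l → *-congˡ (*-congˡ (det-expandRow i (minor zero l M)))) ⟩
    ∑ (λ l → sgn (toℕ l) * (M zero l * ∑ (inner l)))
      ≈⟨ ∑-cong {f = λ l → sgn (toℕ l) * (M zero l * ∑ (inner l))} {g = λ l → ∑ (T l)} (λ l →
           trans (*-congˡ (*-distribˡ-∑ (M zero l) (inner l)))
                 (*-distribˡ-∑ (sgn (toℕ l)) (λ j' → M zero l * inner l j'))) ⟩
    ∑ (λ l → ∑ (T l))
      ≈⟨ ∑∑-punchIn-swap T T' T≈T' ⟩
    ∑ (λ j → ∑ (T' j))
      ≈⟨ ∑-cong {f = λ j → M (suc i) j * cofactor M (suc i) j} {g = λ j → ∑ (T' j)} (λ j →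
           trans (*-congˡ (*-distribˡ-∑ (sgn (suc (toℕ i) ℕ.+ toℕ j)) (expansion j)))
                 (*-distribˡ-∑ (M (suc i) j) (λ l' → sgn (suc (toℕ i) ℕ.+ toℕ j) * expansion j l'))) ⟨
    ∑ (λ j → M (suc i) j * cofactor M (suc i) j) ∎
    where
    inner : Fin (suc (suc n)) → Fin (suc n) → Carrier
    inner l j' = M (suc i) (punchIn l j') * cofactor (minor zero l M) i j'

    minor₂ : Fin (suc (suc n)) → Fin (suc n) → Matrix n
    minor₂ j l' = minor zero l' (minor (suc i) j M)

    expansion : Fin (suc (suc n)) → Fin (suc n) → Carrier
    expansion j l' = sgn (toℕ l') * (M zero (punchIn j l') * det (minor₂ j l'))

    T : Fin (suc (suc n)) → Fin (suc n) → Carrier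
    T l j' = sgn (toℕ l) * (M zero l * inner l j')

    T' : Fin (suc (suc n)) → Fin (suc n) → Carrier
    T' j l' = M (suc i) j * (sgn (suc (toℕ i) ℕ.+ toℕ j) * expansion j l')

    T≈T' : ∀ l j j' l' → j ≡ punchIn l j' → l ≡ punchIn j l' → T l j' ≈ T' j l'
    T≈T' l _ j' l' ≡.refl l≡ = begin
      sl * (M zero l * (mi * (sgn (toℕ i ℕ.+ toℕ j') * det (minor i j' (minor zero l M)))))
        ≈⟨ *-congˡ (*-congˡ (*-congˡ (*-cong (sgn-+ (toℕ i) (toℕ j')) (det-cong (λ x y →
             reflexive (≡.cong (M (suc (punchIn i x))) (punchIn-punchIn-swap l j j' l' ≡.refl (≡.sym l≡) y))))))) ⟩
      sl * (M zero l * (mi * ((si * sj') * d)))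
        ≈⟨ *-exchange-signs sl sj' si sj sl' (M zero l) mi d (sgn-punchIn-pair l j j' l' ≡.refl l≡) ⟩
      mi * (- (si * sj) * (sl' * (M zero l * d)))
        ≈⟨ *-congˡ (*-cong (-‿cong (sgn-+ (toℕ i) (toℕ j))) (*-congˡ (*-congʳ (reflexive (≡.cong (M zero) (≡.sym l≡)))))) ⟨
      mi * (sgn (suc (toℕ i) ℕ.+ toℕ j) * (sl' * (M zero (punchIn j l') * d))) ∎
      where
      j = punchIn l j'
      mi = M (suc i) j
      sl = sgn (toℕ l)
      sj' = sgn (toℕ j')
      sj = sgn (toℕ j)
      sl' = sgn (toℕ l')
      si = sgn (toℕ i)
      d = det (minor₂ j l')

  EqualOffRow : ∀ {n} → Fin n → Matrix n → Matrix n → Set ℓ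
  EqualOffRow ρ C A = ∀ i → i ≢ ρ → ∀ l → C i l ≈ A i l

  cofactor-cong : ∀ {n} {C A : Matrix (suc n)} {ρ} j → EqualOffRow ρ C A → cofactor C ρ j ≈ cofactor A ρ j
  cofactor-cong {ρ = ρ} j C≈A = *-congˡ (det-cong (λ k l → C≈A (punchIn ρ k) (Finₚ.punchInᵢ≢i ρ k) (punchIn j l)))

  det-expandRow-offRow : ∀ {n} (ρ : Fin (suc n)) {C A : Matrix (suc n)} → EqualOffRow ρ C A →
                         det C ≈ ∑ (λ l → C ρ l * cofactor A ρ l)
  det-expandRow-offRow ρ {C} {A} C≈A = trans (det-expandRow ρ C)
    (∑-cong {f = λ l → C ρ l * cofactor C ρ l} {g = λ l → C ρ l * cofactor A ρ l} (λ l → *-congˡ (cofactor-cong l C≈A)))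

  setRow : ∀ {n} → Matrix n → Fin n → (Fin n → Carrier) → Matrix n
  setRow M i v = updateAt M i (const v)

  setRow-updates : ∀ {n} (M : Matrix n) i v l → setRow M i v i l ≈ v l
  setRow-updates M i v l = reflexive (≡.cong (λ row → row l) (updateAt-updates i M))

  setRow-equalOffRow : ∀ {n} (M : Matrix n) i v → EqualOffRow i (setRow M i v) M
  setRow-equalOffRow M i v k k≢i l = reflexive (≡.cong (λ row → row l) (updateAt-minimal k i M k≢i))

  cofactor-diagonal : ∀ {n} (M : Matrix (suc n)) i → cofactor M i i ≈ det (minor i i M)
  cofactor-diagonal M i = trans (*-congʳ (sgn-double (toℕ i))) (*-identityˡ _)

  det₂-equalRows : (M : Matrix 2) → (∀ l → M zero l ≈ M (suc zero) l) → det M ≈ 0#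
  det₂-equalRows M row≈ = begin
    1# * (x * (1# * (M (suc zero) (suc zero) * 1#) + 0#)) + (- 1# * (y * (1# * (M (suc zero) zero * 1#) + 0#)) + 0#)
      ≈⟨ +-cong (*-congˡ (*-congˡ (+-congʳ (*-congˡ (*-congʳ (sym (row≈ (suc zero))))))))
                (+-congʳ (*-congˡ (*-congˡ (+-congʳ (*-congˡ (*-congʳ (sym (row≈ zero)))))))) ⟩
    1# * (x * (1# * (y * 1#) + 0#)) + (- 1# * (y * (1# * (x * 1#) + 0#)) + 0#)
      ≈⟨ solve 3 (λ x y m → con 1 :* (x :* (con 1 :* (y :* con 1) :+ con 0)) :+ (m :* (y :* (con 1 :* (x :* con 1) :+ con 0)) :+ con 0)
                            := x :* y :+ m :* (x :* y)) refl x y (- 1#) ⟩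
    x * y + - 1# * (x * y)  ≈⟨ +-congˡ (-1*x≈-x _) ⟩
    x * y + - (x * y)       ≈⟨ -‿inverseʳ _ ⟩
    0#                      ∎
    where
    x = M zero zero
    y = M zero (suc zero)

  private
    thirdIndex : ∀ {n} (i j : Fin (suc (suc (suc n)))) → Σ (Fin (suc (suc (suc n)))) λ k → k ≢ i × k ≢ j
    thirdIndex (suc _)       (suc _)       = zero , (λ ()) , (λ ())
    thirdIndex zero          zero          = suc zero , (λ ()) , (λ ())
    thirdIndex zero          (suc zero)    = suc (suc zero) , (λ ()) , (λ ())
    thirdIndex zero          (suc (suc _)) = suc zero , (λ ()) , (λ ())
    thirdIndex (suc zero)    zero          = suc (suc zero) , (λ ()) , (λ ())
    thirdIndex (suc (suc _)) zero          = suc zero , (λ ()) , (λ ())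

  det-minorsVanish : ∀ {n} (M : Matrix (suc n)) k → (∀ l → det (minor k l M) ≈ 0#) → det M ≈ 0#
  det-minorsVanish M k minors≈0 = begin
    det M                             ≈⟨ det-expandRow k M ⟩
    ∑ (λ l → M k l * cofactor M k l)  ≈⟨ ∑-zero {f = λ l → M k l * cofactor M k l} (λ l →
                                           trans (*-congˡ (trans (*-congˡ (minors≈0 l)) (zeroʳ _))) (zeroʳ _)) ⟩
    0#                                ∎

  minor-equalRows : ∀ {n} (M : Matrix (suc n)) {i j k} (k≢i : k ≢ i) (k≢j : k ≢ j) → (∀ l → M i l ≈ M j l) →
                    ∀ l l' → minor k l M (punchOut k≢i) l' ≈ minor k l M (punchOut k≢j) l'
  minor-equalRows M {i} {j} {k} k≢i k≢j row≈ l l' = begin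
    M (punchIn k (punchOut k≢i)) (punchIn l l')  ≡⟨ ≡.cong (λ r → M r (punchIn l l')) (Finₚ.punchIn-punchOut k≢i) ⟩
    M i (punchIn l l')                           ≈⟨ row≈ (punchIn l l') ⟩
    M j (punchIn l l')                           ≡⟨ ≡.cong (λ r → M r (punchIn l l')) (Finₚ.punchIn-punchOut k≢j) ⟨
    M (punchIn k (punchOut k≢j)) (punchIn l l')  ∎

  -- for n ≥ 3, expand along a third row: every minor keeps two equal rows
  det-equalRows : ∀ {n} (M : Matrix n) {i j : Fin n} → i ≢ j → (∀ l → M i l ≈ M j l) → det M ≈ 0#
  det-equalRows {zero}           M {()}
  det-equalRows {suc zero}       M {zero}     {zero}     i≢j _    = ⊥-elim (i≢j ≡.refl)
  det-equalRows {suc (suc zero)} M {zero}     {zero}     i≢j _    = ⊥-elim (i≢j ≡.refl)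
  det-equalRows {suc (suc zero)} M {suc zero} {suc zero} i≢j _    = ⊥-elim (i≢j ≡.refl)
  det-equalRows {suc (suc zero)} M {zero}     {suc zero} _   row≈ = det₂-equalRows M row≈
  det-equalRows {suc (suc zero)} M {suc zero} {zero}     _   row≈ = det₂-equalRows M (sym ∘ row≈)
  det-equalRows {suc (suc (suc n))} M {i} {j} i≢j row≈ = det-minorsVanish M k (λ l →
    det-equalRows (minor k l M) (i≢j ∘ Finₚ.punchOut-injective k≢i k≢j) (minor-equalRows M k≢i k≢j row≈ l))
    where
    k = proj₁ (thirdIndex i j)
    k≢i = proj₁ (proj₂ (thirdIndex i j))
    k≢j = proj₂ (proj₂ (thirdIndex i j))

  ∑-alienCofactors : ∀ {n} (M : Matrix (suc n)) {σ ρ} → σ ≢ ρ → ∑ (λ l → M σ l * cofactor M ρ l) ≈ 0#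
  ∑-alienCofactors M {σ} {ρ} σ≢ρ = begin
    ∑ (λ l → M σ l * cofactor M ρ l)  ≈⟨ ∑-cong {f = λ l → C ρ l * cofactor M ρ l} {g = λ l → M σ l * cofactor M ρ l}
                                           (λ l → *-congʳ (setRow-updates M ρ (M σ) l)) ⟨
    ∑ (λ l → C ρ l * cofactor M ρ l)  ≈⟨ det-expandRow-offRow ρ (setRow-equalOffRow M ρ (M σ)) ⟨
    det C                             ≈⟨ det-equalRows C σ≢ρ (λ l →
                                           trans (setRow-equalOffRow M ρ (M σ) σ σ≢ρ l) (sym (setRow-updates M ρ (M σ) l))) ⟩
    0#                                ∎
    where C = setRow M ρ (M σ)

  det-rowReduce : ∀ {n} (M : Matrix (suc n)) {σ ρ} → σ ≢ ρ → ∀ x (w : Fin (suc n) → Carrier) →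
                  (∀ l → M ρ l ≈ x * M σ l + w l) → det M ≈ ∑ (λ l → w l * cofactor M ρ l)
  det-rowReduce M {σ} {ρ} σ≢ρ x w row≈ = begin
    det M
      ≈⟨ det-expandRow ρ M ⟩
    ∑ (λ l → M ρ l * cofactor M ρ l)
      ≈⟨ ∑-cong {f = λ l → M ρ l * cofactor M ρ l} {g = λ l → x * (M σ l * cofactor M ρ l) + w l * cofactor M ρ l}
           (λ l → trans (*-congʳ (row≈ l)) (trans (distribʳ _ _ _) (+-congʳ (*-assoc _ _ _)))) ⟩
    ∑ (λ l → x * (M σ l * cofactor M ρ l) + w l * cofactor M ρ l)
      ≈⟨ ∑-distrib-+ (λ l → x * (M σ l * cofactor M ρ l)) (λ l → w l * cofactor M ρ l) ⟩
    ∑ (λ l → x * (M σ l * cofactor M ρ l)) + ∑ (λ l → w l * cofactor M ρ l)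
      ≈⟨ +-congʳ (*-distribˡ-∑ x (λ l → M σ l * cofactor M ρ l)) ⟨
    x * ∑ (λ l → M σ l * cofactor M ρ l) + ∑ (λ l → w l * cofactor M ρ l)
      ≈⟨ +-congʳ (trans (*-congˡ (∑-alienCofactors M σ≢ρ)) (zeroʳ x)) ⟩
    0# + ∑ (λ l → w l * cofactor M ρ l)
      ≈⟨ +-identityˡ _ ⟩
    ∑ (λ l → w l * cofactor M ρ l) ∎

  det-rowPerturb : ∀ {n} {Q A : Matrix (suc n)} (ρ j : Fin (suc n)) y → EqualOffRow ρ Q A →
                   (∀ l → Q ρ l ≈ A ρ l + y * δ j l) → det Q ≈ det A + y * cofactor A ρ j
  det-rowPerturb {Q = Q} {A} ρ j y Q≈A row≈ = begin
    det Q
      ≈⟨ det-expandRow-offRow ρ Q≈A ⟩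
    ∑ (λ l → Q ρ l * cofactor A ρ l)
      ≈⟨ ∑-cong {f = λ l → Q ρ l * cofactor A ρ l} {g = λ l → A ρ l * cofactor A ρ l + (y * δ j l) * cofactor A ρ l}
           (λ l → trans (*-congʳ (row≈ l)) (distribʳ _ _ _)) ⟩
    ∑ (λ l → A ρ l * cofactor A ρ l + (y * δ j l) * cofactor A ρ l)
      ≈⟨ ∑-distrib-+ (λ l → A ρ l * cofactor A ρ l) (λ l → (y * δ j l) * cofactor A ρ l) ⟩
    ∑ (λ l → A ρ l * cofactor A ρ l) + ∑ (λ l → (y * δ j l) * cofactor A ρ l)
      ≈⟨ +-cong (sym (det-expandRow ρ A)) (∑-scaledδ y j (cofactor A ρ)) ⟩
    det A + y * cofactor A ρ j ∎

  det-setRow : ∀ {n} (M : Matrix (suc n)) i v → det (setRow M i v) ≈ ∑ (λ l → v l * cofactor M i l)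
  det-setRow M i v = trans (det-expandRow-offRow i (setRow-equalOffRow M i v))
    (∑-cong {f = λ l → setRow M i v i l * cofactor M i l} {g = λ l → v l * cofactor M i l}
            (λ l → *-congʳ (setRow-updates M i v l)))

  minor₀₀-setRow : ∀ {n} (M : Matrix (suc (suc n))) i v k l →
                   minor zero zero (setRow M (suc i) v) k l ≈ setRow (minor zero zero M) i (v ∘ suc) k l
  minor₀₀-setRow M i v k l with k Finₚ.≟ i
  ... | yes ≡.refl = trans (setRow-updates M (suc i) v (suc l)) (sym (setRow-updates (minor zero zero M) i (v ∘ suc) l))
  ... | no k≢i     = trans (setRow-equalOffRow M (suc i) v (suc k) (k≢i ∘ Finₚ.suc-injective) (suc l))
                           (sym (setRow-equalOffRow (minor zero zero M) i (v ∘ suc) k k≢i l))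

module Toeplitz {c ℓ : Level} (R : CommutativeRing c ℓ) (a a' : CommutativeRing.Carrier R) where
  open CommutativeRing R hiding (zero)
  open Det R
  open Determinant R
  open RingProperties ring
  open SetoidReasoning setoid
  open NaturalCoefficientSolver commutativeSemiring using (solve; _:=_; _:+_; _:*_; con)

  -- the entries of D(K_p; a, a') as a function of ℕ indices: minors of K are then again entry
  -- composed with punchInℕ on both indices
  entry : ℕ → ℕ → Carrier
  entry zero    zero    = 0#
  entry zero    (suc _) = a
  entry (suc _) zero    = a'
  entry (suc x) (suc y) = entry x y

  entry-< : ∀ {x y} → x ℕ.< y → entry x y ≡ a
  entry-< {zero}  {suc y} _         = ≡.refl
  entry-< {suc x} {suc y} (s≤s x<y) = entry-< x<y

  entry-> : ∀ {x y} → y ℕ.< x → entry x y ≡ a'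
  entry-> {suc x} {zero}  _         = ≡.refl
  entry-> {suc x} {suc y} (s≤s y<x) = entry-> y<x

  entry-diagonal : ∀ x → entry x x ≡ 0#
  entry-diagonal zero    = ≡.refl
  entry-diagonal (suc x) = entry-diagonal x

  DK≡entry : ∀ p (i j : Fin p) → DK p a a' i j ≡ entry (toℕ i) (toℕ j)
  DK≡entry p i j with i Finₚ.<? j | j Finₚ.<? i
  ... | yes i<j | _       = ≡.sym (entry-< i<j)
  ... | no _    | yes j<i = ≡.sym (entry-> j<i)
  ... | no i≮j  | no j≮i  = ≡.trans (≡.sym (entry-diagonal (toℕ i)))
                                     (≡.cong (entry (toℕ i)) (ℕₚ.≤-antisym (ℕₚ.≮⇒≥ j≮i) (ℕₚ.≮⇒≥ i≮j)))

  entry-punchInℕ : ∀ t x y → entry (punchInℕ t x) (punchInℕ t y) ≡ entry x y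
  entry-punchInℕ zero    x       y       = ≡.refl
  entry-punchInℕ (suc t) zero    zero    = ≡.refl
  entry-punchInℕ (suc t) zero    (suc y) = ≡.refl
  entry-punchInℕ (suc t) (suc x) zero    = ≡.refl
  entry-punchInℕ (suc t) (suc x) (suc y) = entry-punchInℕ t x y

  -- K (2 + m) without row r and column r + 1 (resp. row c + 1 and column c) agrees with K (1 + m)
  -- outside row r (resp. c)
  entry-punchIn-offRow⁺ : ∀ r x y → x ≢ r → entry (punchInℕ r x) (punchInℕ (suc r) y) ≡ entry x y
  entry-punchIn-offRow⁺ zero    zero    y       x≢r = ⊥-elim (x≢r ≡.refl)
  entry-punchIn-offRow⁺ zero    (suc x) zero    _   = ≡.refl
  entry-punchIn-offRow⁺ zero    (suc x) (suc y) _   = ≡.refl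
  entry-punchIn-offRow⁺ (suc r) zero    zero    _   = ≡.refl
  entry-punchIn-offRow⁺ (suc r) zero    (suc y) _   = ≡.refl
  entry-punchIn-offRow⁺ (suc r) (suc x) zero    _   = ≡.refl
  entry-punchIn-offRow⁺ (suc r) (suc x) (suc y) x≢r = entry-punchIn-offRow⁺ r x y (x≢r ∘ ≡.cong suc)

  entry-punchIn-offRow⁻ : ∀ c x y → x ≢ c → entry (punchInℕ (suc c) x) (punchInℕ c y) ≡ entry x y
  entry-punchIn-offRow⁻ zero    zero    y       x≢c = ⊥-elim (x≢c ≡.refl)
  entry-punchIn-offRow⁻ zero    (suc x) zero    _   = ≡.refl
  entry-punchIn-offRow⁻ zero    (suc x) (suc y) _   = ≡.refl
  entry-punchIn-offRow⁻ (suc c) zero    zero    _   = ≡.refl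
  entry-punchIn-offRow⁻ (suc c) zero    (suc y) _   = ≡.refl
  entry-punchIn-offRow⁻ (suc c) (suc x) zero    _   = ≡.refl
  entry-punchIn-offRow⁻ (suc c) (suc x) (suc y) x≢c = entry-punchIn-offRow⁻ c x y (x≢c ∘ ≡.cong suc)

  private
    x≈x+y*0 : ∀ x y → x ≈ x + y * 0#
    x≈x+y*0 x y = sym (trans (+-congˡ (zeroʳ y)) (+-identityʳ x))

    y≈0+y*1 : ∀ y → y ≈ 0# + y * 1#
    y≈0+y*1 y = sym (trans (+-identityˡ _) (*-identityʳ y))

  entry-punchIn-row⁺ : ∀ r y → entry (suc r) (punchInℕ (suc r) y) ≈ entry r y + a' * δℕ r y
  entry-punchIn-row⁺ zero    zero    = y≈0+y*1 a'
  entry-punchIn-row⁺ zero    (suc y) = x≈x+y*0 a a'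
  entry-punchIn-row⁺ (suc r) zero    = x≈x+y*0 a' a'
  entry-punchIn-row⁺ (suc r) (suc y) = entry-punchIn-row⁺ r y

  entry-punchIn-row⁻ : ∀ c y → entry c (punchInℕ c y) ≈ entry c y + a * δℕ c y
  entry-punchIn-row⁻ zero    zero    = y≈0+y*1 a
  entry-punchIn-row⁻ zero    (suc y) = x≈x+y*0 a a
  entry-punchIn-row⁻ (suc c) zero    = x≈x+y*0 a' a
  entry-punchIn-row⁻ (suc c) (suc y) = entry-punchIn-row⁻ c y

  entry-punchInℕ-suc : ∀ t y → entry t (punchInℕ (suc t) y) ≡ entry t y
  entry-punchInℕ-suc zero    zero    = ≡.refl
  entry-punchInℕ-suc zero    (suc y) = ≡.refl
  entry-punchInℕ-suc (suc t) zero    = ≡.refl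
  entry-punchInℕ-suc (suc t) (suc y) = entry-punchInℕ-suc t y

  entry-suc-punchInℕ : ∀ c y → entry (suc c) (punchInℕ c y) ≡ entry c y
  entry-suc-punchInℕ zero    y       = ≡.refl
  entry-suc-punchInℕ (suc c) zero    = ≡.refl
  entry-suc-punchInℕ (suc c) (suc y) = entry-suc-punchInℕ c y

  K : ∀ n → Matrix n
  K n i j = entry (toℕ i) (toℕ j)

  D : ℕ → Carrier
  D n = det (K n)

  minorDet : ℕ → ℕ → ℕ → Carrier
  minorDet n r c = det {n} (λ k l → entry (punchInℕ r (toℕ k)) (punchInℕ c (toℕ l)))

  cofactor-K : ∀ {n} (i j : Fin (suc n)) → cofactor (K (suc n)) i j ≈ sgn (toℕ i ℕ.+ toℕ j) * minorDet n (toℕ i) (toℕ j)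
  cofactor-K i j = *-congˡ (det-cong (λ k l → reflexive (≡.cong₂ entry (toℕ-punchIn i k) (toℕ-punchIn j l))))

  minorDet-diagonal : ∀ n r → minorDet n r r ≈ D n
  minorDet-diagonal n r = det-cong {n} (λ k l → reflexive (entry-punchInℕ r (toℕ k) (toℕ l)))

  cofactor-K-diagonal : ∀ {n} (i : Fin (suc n)) → cofactor (K (suc n)) i i ≈ D n
  cofactor-K-diagonal {n} i =
    trans (cofactor-K i i) (trans (*-cong (sgn-double (toℕ i)) (minorDet-diagonal n (toℕ i))) (*-identityˡ _))

  inject₁≢suc : ∀ {n} (τ : Fin n) → Fin.inject₁ τ ≢ suc τ
  inject₁≢suc τ e = ℕₚ.1+n≢n (≡.sym (≡.trans (≡.sym (Finₚ.toℕ-inject₁ τ)) (≡.cong toℕ e)))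

  minorDet-super : ∀ m r → r ℕ.≤ m → minorDet (suc m) r (suc r) ≈ D (suc m) + a' * D m
  minorDet-super m _ r≤m with Fin.fromℕ< (s≤s r≤m) | Finₚ.toℕ-fromℕ< (s≤s r≤m)
  ... | ρ | ≡.refl = begin
    det Q                                      ≈⟨ det-rowPerturb ρ ρ a' Q≈K row-ρ ⟩
    D (suc m) + a' * cofactor (K (suc m)) ρ ρ  ≈⟨ +-congˡ (*-congˡ (cofactor-K-diagonal ρ)) ⟩
    D (suc m) + a' * D m                       ∎
    where
    r = toℕ ρ
    Q : Matrix (suc m)
    Q k l = entry (punchInℕ r (toℕ k)) (punchInℕ (suc r) (toℕ l))
    Q≈K : EqualOffRow ρ Q (K (suc m))
    Q≈K i i≢ρ l = reflexive (entry-punchIn-offRow⁺ r (toℕ i) (toℕ l) (i≢ρ ∘ Finₚ.toℕ-injective))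
    row-ρ : ∀ l → Q ρ l ≈ K (suc m) ρ l + a' * δ ρ l
    row-ρ l = trans (reflexive (≡.cong (λ x → entry x (punchInℕ (suc r) (toℕ l))) (punchInℕ-≥ ℕₚ.≤-refl)))
                    (entry-punchIn-row⁺ r (toℕ l))

  minorDet-sub : ∀ m c → c ℕ.≤ m → minorDet (suc m) (suc c) c ≈ D (suc m) + a * D m
  minorDet-sub m _ c≤m with Fin.fromℕ< (s≤s c≤m) | Finₚ.toℕ-fromℕ< (s≤s c≤m)
  ... | ρ | ≡.refl = begin
    det Q                                     ≈⟨ det-rowPerturb ρ ρ a Q≈K row-ρ ⟩
    D (suc m) + a * cofactor (K (suc m)) ρ ρ  ≈⟨ +-congˡ (*-congˡ (cofactor-K-diagonal ρ)) ⟩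
    D (suc m) + a * D m                       ∎
    where
    c' = toℕ ρ
    Q : Matrix (suc m)
    Q k l = entry (punchInℕ (suc c') (toℕ k)) (punchInℕ c' (toℕ l))
    Q≈K : EqualOffRow ρ Q (K (suc m))
    Q≈K i i≢ρ l = reflexive (entry-punchIn-offRow⁻ c' (toℕ i) (toℕ l) (i≢ρ ∘ Finₚ.toℕ-injective))
    row-ρ : ∀ l → Q ρ l ≈ K (suc m) ρ l + a * δ ρ l
    row-ρ l = trans (reflexive (≡.cong (λ x → entry x (punchInℕ c' (toℕ l))) (punchInℕ-< (ℕₚ.n<1+n c'))))
                    (entry-punchIn-row⁻ c' (toℕ l))

  -- rows t and t + 1 of this minor differ by a' e_{t+1}, and deleting row and column t + 1 leaves
  -- a minor of the same shape
  minorDet-shiftCol : ∀ m r t → r ℕ.≤ t → t ℕ.≤ m →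
                      minorDet (suc (suc m)) r (suc (suc t)) ≈ a' * minorDet (suc m) r (suc t)
  minorDet-shiftCol m r _ r≤t t≤m with Fin.fromℕ< (s≤s t≤m) | Finₚ.toℕ-fromℕ< (s≤s t≤m)
  ... | τ | ≡.refl = begin
    det Q                                                ≈⟨ det-rowReduce Q (inject₁≢suc τ) 1# (λ l → a' * δ (suc τ) l) rows ⟩
    ∑ (λ l → (a' * δ (suc τ) l) * cofactor Q (suc τ) l)  ≈⟨ ∑-scaledδ a' (suc τ) (cofactor Q (suc τ)) ⟩
    a' * cofactor Q (suc τ) (suc τ)                      ≈⟨ *-congˡ (trans (cofactor-diagonal Q (suc τ)) (det-cong minor≈)) ⟩
    a' * minorDet (suc m) r (suc t)                      ∎
    where
    t = toℕ τ
    Q : Matrix (suc (suc m))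
    Q k l = entry (punchInℕ r (toℕ k)) (punchInℕ (suc (suc t)) (toℕ l))
    rows : ∀ l → Q (suc τ) l ≈ 1# * Q (Fin.inject₁ τ) l + a' * δ (suc τ) l
    rows l = begin
      entry (punchInℕ r (suc t)) (punchInℕ (suc (suc t)) (toℕ l))
        ≡⟨ ≡.cong (λ x → entry x (punchInℕ (suc (suc t)) (toℕ l))) (punchInℕ-≥ (ℕₚ.m≤n⇒m≤1+n r≤t)) ⟩
      entry (suc (suc t)) (punchInℕ (suc (suc t)) (toℕ l))
        ≈⟨ entry-punchIn-row⁺ (suc t) (toℕ l) ⟩
      entry (suc t) (toℕ l) + a' * δ (suc τ) l
        ≡⟨ ≡.cong (_+ a' * δ (suc τ) l) (entry-punchInℕ-suc (suc t) (toℕ l)) ⟨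
      entry (suc t) (punchInℕ (suc (suc t)) (toℕ l)) + a' * δ (suc τ) l
        ≡⟨ ≡.cong (λ x → entry x (punchInℕ (suc (suc t)) (toℕ l)) + a' * δ (suc τ) l)
             (≡.trans (≡.cong (punchInℕ r) (Finₚ.toℕ-inject₁ τ)) (punchInℕ-≥ r≤t)) ⟨
      entry (punchInℕ r (toℕ (Fin.inject₁ τ))) (punchInℕ (suc (suc t)) (toℕ l)) + a' * δ (suc τ) l
        ≈⟨ +-congʳ (*-identityˡ _) ⟨
      1# * Q (Fin.inject₁ τ) l + a' * δ (suc τ) l ∎
    minor≈ : ∀ k l → minor (suc τ) (suc τ) Q k l ≈ entry (punchInℕ r (toℕ k)) (punchInℕ (suc t) (toℕ l))
    minor≈ k l = begin
      entry (punchInℕ r (toℕ (punchIn (suc τ) k))) (punchInℕ (suc (suc t)) (toℕ (punchIn (suc τ) l)))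
        ≡⟨ ≡.cong₂ (λ x y → entry (punchInℕ r x) (punchInℕ (suc (suc t)) y)) (toℕ-punchIn (suc τ) k) (toℕ-punchIn (suc τ) l) ⟩
      entry (punchInℕ r (punchInℕ (suc t) (toℕ k))) (punchInℕ (suc (suc t)) (punchInℕ (suc t) (toℕ l)))
        ≡⟨ ≡.cong (λ x → entry x _) (punchInℕ-punchInℕ r (suc t) (toℕ k) (ℕₚ.m≤n⇒m≤1+n r≤t)) ⟩
      entry (punchInℕ (suc (suc t)) (punchInℕ r (toℕ k))) (punchInℕ (suc (suc t)) (punchInℕ (suc t) (toℕ l)))
        ≡⟨ entry-punchInℕ (suc (suc t)) (punchInℕ r (toℕ k)) (punchInℕ (suc t) (toℕ l)) ⟩
      entry (punchInℕ r (toℕ k)) (punchInℕ (suc t) (toℕ l)) ∎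

  minorDet-shiftRow : ∀ m r t → t ℕ.< r → t ℕ.≤ m →
                      minorDet (suc (suc m)) (suc r) t ≈ a * minorDet (suc m) r t
  minorDet-shiftRow m r _ t<r t≤m with Fin.fromℕ< (s≤s t≤m) | Finₚ.toℕ-fromℕ< (s≤s t≤m)
  ... | τ | ≡.refl = begin
    det Q                                   ≈⟨ det-rowReduce Q (inject₁≢suc τ ∘ ≡.sym) 1# (λ l → a * δ ρ l) rows ⟩
    ∑ (λ l → (a * δ ρ l) * cofactor Q ρ l)  ≈⟨ ∑-scaledδ a ρ (cofactor Q ρ) ⟩
    a * cofactor Q ρ ρ                      ≈⟨ *-congˡ (trans (cofactor-diagonal Q ρ) (det-cong minor≈)) ⟩
    a * minorDet (suc m) r t                ∎
    where
    t = toℕ τ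
    ρ = Fin.inject₁ τ
    Q : Matrix (suc (suc m))
    Q k l = entry (punchInℕ (suc r) (toℕ k)) (punchInℕ t (toℕ l))
    toℕ-punchIn-ρ : ∀ (k : Fin (suc m)) → toℕ (punchIn ρ k) ≡ punchInℕ t (toℕ k)
    toℕ-punchIn-ρ k = ≡.trans (toℕ-punchIn ρ k) (≡.cong (λ z → punchInℕ z (toℕ k)) (Finₚ.toℕ-inject₁ τ))
    rows : ∀ l → Q ρ l ≈ 1# * Q (suc τ) l + a * δ ρ l
    rows l = begin
      entry (punchInℕ (suc r) (toℕ ρ)) (punchInℕ t (toℕ l))
        ≡⟨ ≡.cong (λ x → entry x (punchInℕ t (toℕ l)))
             (≡.trans (≡.cong (punchInℕ (suc r)) (Finₚ.toℕ-inject₁ τ)) (punchInℕ-< (ℕₚ.m<n⇒m<1+n t<r))) ⟩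
      entry t (punchInℕ t (toℕ l))
        ≈⟨ entry-punchIn-row⁻ t (toℕ l) ⟩
      entry t (toℕ l) + a * δℕ t (toℕ l)
        ≡⟨ ≡.cong₂ (λ x j → x + a * δℕ j (toℕ l)) (entry-suc-punchInℕ t (toℕ l)) (Finₚ.toℕ-inject₁ τ) ⟨
      entry (suc t) (punchInℕ t (toℕ l)) + a * δ ρ l
        ≡⟨ ≡.cong (λ x → entry x (punchInℕ t (toℕ l)) + a * δ ρ l) (punchInℕ-< (s≤s t<r)) ⟨
      Q (suc τ) l + a * δ ρ l
        ≈⟨ +-congʳ (*-identityˡ _) ⟨
      1# * Q (suc τ) l + a * δ ρ l ∎
    minor≈ : ∀ k l → minor ρ ρ Q k l ≈ entry (punchInℕ r (toℕ k)) (punchInℕ t (toℕ l))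
    minor≈ k l = begin
      entry (punchInℕ (suc r) (toℕ (punchIn ρ k))) (punchInℕ t (toℕ (punchIn ρ l)))
        ≡⟨ ≡.cong₂ (λ x y → entry (punchInℕ (suc r) x) (punchInℕ t y)) (toℕ-punchIn-ρ k) (toℕ-punchIn-ρ l) ⟩
      entry (punchInℕ (suc r) (punchInℕ t (toℕ k))) (punchInℕ t (punchInℕ t (toℕ l)))
        ≡⟨ ≡.cong (λ x → entry x (punchInℕ t (punchInℕ t (toℕ l)))) (punchInℕ-punchInℕ t r (toℕ k) (ℕₚ.<⇒≤ t<r)) ⟨
      entry (punchInℕ t (punchInℕ r (toℕ k))) (punchInℕ t (punchInℕ t (toℕ l)))
        ≡⟨ entry-punchInℕ t (punchInℕ r (toℕ k)) (punchInℕ t (toℕ l)) ⟩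
      entry (punchInℕ r (toℕ k)) (punchInℕ t (toℕ l)) ∎

  private
    [-y*d+x*-S]+y*d≈-[x*S] : ∀ x y d S → ((- y) * d + x * - S) + y * d ≈ - (x * S)
    [-y*d+x*-S]+y*d≈-[x*S] x y d S = begin
      ((- y) * d + x * - S) + y * d
        ≈⟨ solve 3 (λ p q r → (p :+ q) :+ r := q :+ (p :+ r)) refl ((- y) * d) (x * - S) (y * d) ⟩
      x * - S + ((- y) * d + y * d)
        ≈⟨ +-congˡ (trans (sym (distribʳ d (- y) y)) (trans (*-congʳ (-‿inverseˡ y)) (zeroˡ d))) ⟩
      x * - S + 0#  ≈⟨ +-identityʳ _ ⟩
      x * - S       ≈⟨ -‿distribʳ-* x S ⟨
      - (x * S)     ∎

  D+a'D-recurrence : ∀ n → D (suc (suc n)) + a' * D (suc n) ≈ - (a * (D (suc n) + a' * D n))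
  D+a'D-recurrence n = trans (+-congʳ expansion) ([-y*d+x*-S]+y*d≈-[x*S] a a' (D (suc n)) _)
    where
    w : Fin (suc (suc n)) → Carrier
    w l = (- a') * δ zero l + a * δ (suc zero) l
    rows : ∀ l → K (suc (suc n)) zero l ≈ 1# * K (suc (suc n)) (suc zero) l + w l
    rows zero = sym (begin
      1# * a' + ((- a') * 1# + a * 0#)  ≈⟨ solve 3 (λ x y z → con 1 :* x :+ (y :* con 1 :+ z :* con 0) := x :+ y) refl a' (- a') a ⟩
      a' + - a'                         ≈⟨ -‿inverseʳ a' ⟩
      0#                                ∎)
    rows (suc zero) = sym (solve 3 (λ x y z → con 1 :* con 0 :+ (y :* con 0 :+ z :* con 1) := z) refl a' (- a') a)
    rows (suc (suc _)) = sym (solve 2 (λ y z → con 1 :* z :+ (y :* con 0 :+ z :* con 0) := z) refl (- a') a)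
    expansion : D (suc (suc n)) ≈ (- a') * D (suc n) + a * - (D (suc n) + a' * D n)
    expansion = begin
      D (suc (suc n))
        ≈⟨ det-rowReduce (K (suc (suc n))) {suc zero} {zero} (λ ()) 1# w rows ⟩
      ∑ (λ l → w l * cofactor (K (suc (suc n))) zero l)
        ≈⟨ ∑-δ₂ (- a') a zero (suc zero) (cofactor (K (suc (suc n))) zero) ⟩
      (- a') * cofactor (K (suc (suc n))) zero zero + a * cofactor (K (suc (suc n))) zero (suc zero)
        ≈⟨ +-cong (*-congˡ (cofactor-K-diagonal {suc n} zero))
                  (*-congˡ (trans (cofactor-K {suc n} zero (suc zero)) (trans (-1*x≈-x _) (-‿cong (minorDet-super n 0 ℕ.z≤n))))) ⟩
      (- a') * D (suc n) + a * - (D (suc n) + a' * D n) ∎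

  D+aD-recurrence : ∀ n → D (suc (suc n)) + a * D (suc n) ≈ - (a' * (D (suc n) + a * D n))
  D+aD-recurrence n = trans (+-congʳ expansion) ([-y*d+x*-S]+y*d≈-[x*S] a' a (D (suc n)) _)
    where
    w : Fin (suc (suc n)) → Carrier
    w l = (- a) * δ (suc zero) l + a' * δ zero l
    rows : ∀ l → K (suc (suc n)) (suc zero) l ≈ 1# * K (suc (suc n)) zero l + w l
    rows zero = sym (solve 3 (λ x y z → con 1 :* con 0 :+ (y :* con 0 :+ x :* con 1) := x) refl a' (- a) a)
    rows (suc zero) = sym (begin
      1# * a + ((- a) * 1# + a' * 0#)  ≈⟨ solve 3 (λ x y z → con 1 :* z :+ (y :* con 1 :+ x :* con 0) := z :+ y) refl a' (- a) a ⟩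
      a + - a                          ≈⟨ -‿inverseʳ a ⟩
      0#                               ∎)
    rows (suc (suc _)) = sym (solve 3 (λ x y z → con 1 :* z :+ (y :* con 0 :+ x :* con 0) := z) refl a' (- a) a)
    expansion : D (suc (suc n)) ≈ (- a) * D (suc n) + a' * - (D (suc n) + a * D n)
    expansion = begin
      D (suc (suc n))
        ≈⟨ det-rowReduce (K (suc (suc n))) {zero} {suc zero} (λ ()) 1# w rows ⟩
      ∑ (λ l → w l * cofactor (K (suc (suc n))) (suc zero) l)
        ≈⟨ ∑-δ₂ (- a) a' (suc zero) zero (cofactor (K (suc (suc n))) (suc zero)) ⟩
      (- a) * cofactor (K (suc (suc n))) (suc zero) (suc zero) + a' * cofactor (K (suc (suc n))) (suc zero) zero
        ≈⟨ +-cong (*-congˡ (cofactor-K-diagonal {suc n} (suc zero)))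
                  (*-congˡ (trans (cofactor-K {suc n} (suc zero) zero) (trans (-1*x≈-x _) (-‿cong (minorDet-sub n 0 ℕ.z≤n))))) ⟩
      (- a) * D (suc n) + a' * - (D (suc n) + a * D n) ∎

  H-suc : ∀ k → H a a' (suc k) ≈ a' ^ k + a * H a a' k
  H-suc k = begin
    1# * a' ^ k + ∑ {k} (λ s → (a * a ^ toℕ s) * a' ^ (k ∸ suc (toℕ s)))
      ≈⟨ +-cong (*-identityˡ _) (∑-cong {k} {f = λ s → (a * a ^ toℕ s) * a' ^ (k ∸ suc (toℕ s))} {g = term} (λ s →
           trans (*-assoc _ _ _) (*-congˡ (*-congˡ (reflexive (≡.cong (a' ^_) (≡.sym (ℕₚ.∸-+-assoc k 1 (toℕ s))))))))) ⟩
    a' ^ k + ∑ term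
      ≈⟨ +-congˡ (*-distribˡ-∑ {k} a (λ s → a ^ toℕ s * a' ^ (k ∸ 1 ∸ toℕ s))) ⟨
    a' ^ k + a * H a a' k ∎
    where
    term : Fin k → Carrier
    term s = a * (a ^ toℕ s * a' ^ (k ∸ 1 ∸ toℕ s))

  H-suc′ : ∀ k → H a a' (suc k) ≈ a ^ k + a' * H a a' k
  H-suc′ zero    = trans (H-suc 0) (+-congˡ (trans (zeroʳ a) (sym (zeroʳ a'))))
  H-suc′ (suc k) = begin
    H a a' (suc (suc k))                    ≈⟨ H-suc (suc k) ⟩
    a' * a' ^ k + a * H a a' (suc k)        ≈⟨ +-congˡ (*-congˡ (H-suc′ k)) ⟩
    a' * a' ^ k + a * (a ^ k + a' * H a a' k)
      ≈⟨ solve 5 (λ x y p q h → y :* p :+ x :* (q :+ y :* h) := x :* q :+ y :* (p :+ x :* h)) refl a a' (a' ^ k) (a ^ k) (H a a' k) ⟩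
    a * a ^ k + a' * (a' ^ k + a * H a a' k) ≈⟨ +-congˡ (*-congˡ (H-suc k)) ⟨
    a * a ^ k + a' * H a a' (suc k)         ∎

  private
    D₁+y*D₀ : ∀ y → D 1 + y * D 0 ≈ sgn 0 * (y * a ^ 0)
    D₁+y*D₀ y = solve 1 (λ y → (con 1 :* (con 0 :* con 1) :+ con 0) :+ y :* con 1 := con 1 :* (y :* con 1)) refl y

    -x*[s*p]≈-s*[x*p] : ∀ x s p → - x * (s * p) ≈ - s * (x * p)
    -x*[s*p]≈-s*[x*p] x s p = begin
      - x * (s * p)    ≈⟨ -‿distribˡ-* x _ ⟨
      - (x * (s * p))  ≈⟨ -‿cong (solve 3 (λ x s p → x :* (s :* p) := s :* (x :* p)) refl x s p) ⟩
      - (s * (x * p))  ≈⟨ -‿distribˡ-* s _ ⟩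
      - s * (x * p)    ∎

  D+a'D-closed : ∀ m → D (suc m) + a' * D m ≈ sgn m * (a' * a ^ m)
  D+a'D-closed zero    = D₁+y*D₀ a'
  D+a'D-closed (suc m) = begin
    D (suc (suc m)) + a' * D (suc m)  ≈⟨ D+a'D-recurrence m ⟩
    - (a * (D (suc m) + a' * D m))    ≈⟨ -‿cong (*-congˡ (D+a'D-closed m)) ⟩
    - (a * (sgn m * (a' * a ^ m)))    ≈⟨ trans (-‿distribˡ-* a _) (-x*[s*p]≈-s*[x*p] a (sgn m) _) ⟩
    - sgn m * (a * (a' * a ^ m))      ≈⟨ *-congˡ (solve 3 (λ x y p → x :* (y :* p) := y :* (x :* p)) refl a a' (a ^ m)) ⟩
    - sgn m * (a' * (a * a ^ m))      ∎

  D+aD-closed : ∀ m → D (suc m) + a * D m ≈ sgn m * (a * a' ^ m)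
  D+aD-closed zero    = D₁+y*D₀ a
  D+aD-closed (suc m) = begin
    D (suc (suc m)) + a * D (suc m)  ≈⟨ D+aD-recurrence m ⟩
    - (a' * (D (suc m) + a * D m))   ≈⟨ -‿cong (*-congˡ (D+aD-closed m)) ⟩
    - (a' * (sgn m * (a * a' ^ m)))  ≈⟨ trans (-‿distribˡ-* a' _) (-x*[s*p]≈-s*[x*p] a' (sgn m) _) ⟩
    - sgn m * (a' * (a * a' ^ m))    ≈⟨ *-congˡ (solve 3 (λ x y p → y :* (x :* p) := x :* (y :* p)) refl a a' (a' ^ m)) ⟩
    - sgn m * (a * (a' * a' ^ m))    ∎

  D-closed : ∀ n → D (suc n) ≈ sgn n * (a * (a' * H a a' n))
  D-closed zero    = solve 2 (λ x y → con 1 :* (con 0 :* con 1) :+ con 0 := con 1 :* (x :* (y :* con 0))) refl a a'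
  D-closed (suc n) = begin
    D (suc (suc n))
      ≈⟨ +-identityʳ _ ⟨
    D (suc (suc n)) + 0#
      ≈⟨ +-congˡ (-‿inverseʳ (a' * D (suc n))) ⟨
    D (suc (suc n)) + (a' * D (suc n) + - (a' * D (suc n)))
      ≈⟨ +-assoc _ _ _ ⟨
    (D (suc (suc n)) + a' * D (suc n)) + - (a' * D (suc n))
      ≈⟨ +-cong (D+a'D-closed (suc n)) (-‿cong (*-congˡ (D-closed n))) ⟩
    - s * (a' * (a * a ^ n)) + - (a' * (s * (a * (a' * H a a' n))))
      ≈⟨ +-cong (-‿distribˡ-* s _) (-‿cong (solve 5 (λ s x y p h → s :* (x :* (y :* (y :* h))) := y :* (s :* (x :* (y :* h))))
                                                        refl s a a' (a ^ n) (H a a' n))) ⟨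
    - (s * (a' * (a * a ^ n))) + - (s * (a * (a' * (a' * H a a' n))))
      ≈⟨ -‿+-comm _ _ ⟩
    - (s * (a' * (a * a ^ n)) + s * (a * (a' * (a' * H a a' n))))
      ≈⟨ -‿cong (solve 5 (λ s x y p h → s :* (y :* (x :* p)) :+ s :* (x :* (y :* (y :* h))) := s :* (x :* (y :* (p :+ y :* h))))
                         refl s a a' (a ^ n) (H a a' n)) ⟩
    - (s * (a * (a' * (a ^ n + a' * H a a' n))))
      ≈⟨ -‿cong (*-congˡ (*-congˡ (*-congˡ (H-suc′ n)))) ⟨
    - (s * (a * (a' * H a a' (suc n))))
      ≈⟨ -‿distribˡ-* s _ ⟩
    - s * (a * (a' * H a a' (suc n))) ∎
    where s = sgn n

  minorDet-upper : ∀ m r d → d ℕ.+ r ℕ.≤ m → minorDet (suc m) r (suc (d ℕ.+ r)) ≈ sgn (m ∸ d) * (a' ^ suc d * a ^ (m ∸ d))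
  minorDet-upper m r zero r≤m = begin
    minorDet (suc m) r (suc r)  ≈⟨ minorDet-super m r r≤m ⟩
    D (suc m) + a' * D m        ≈⟨ D+a'D-closed m ⟩
    sgn m * (a' * a ^ m)        ≈⟨ *-congˡ (*-congʳ (*-identityʳ a')) ⟨
    sgn m * (a' ^ 1 * a ^ m)    ∎
  minorDet-upper (suc m) r (suc d) (s≤s d+r≤m) = begin
    minorDet (suc (suc m)) r (suc (suc (d ℕ.+ r)))  ≈⟨ minorDet-shiftCol m r (d ℕ.+ r) (ℕₚ.m≤n+m r d) d+r≤m ⟩
    a' * minorDet (suc m) r (suc (d ℕ.+ r))         ≈⟨ *-congˡ (minorDet-upper m r d d+r≤m) ⟩
    a' * (sgn (m ∸ d) * (a' ^ suc d * a ^ (m ∸ d)))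
      ≈⟨ solve 4 (λ x s p q → x :* (s :* (p :* q)) := s :* ((x :* p) :* q)) refl a' (sgn (m ∸ d)) (a' ^ suc d) (a ^ (m ∸ d)) ⟩
    sgn (m ∸ d) * (a' ^ suc (suc d) * a ^ (m ∸ d))  ∎

  minorDet-lower : ∀ m c d → d ℕ.+ c ℕ.≤ m → minorDet (suc m) (suc (d ℕ.+ c)) c ≈ sgn (m ∸ d) * (a ^ suc d * a' ^ (m ∸ d))
  minorDet-lower m c zero c≤m = begin
    minorDet (suc m) (suc c) c  ≈⟨ minorDet-sub m c c≤m ⟩
    D (suc m) + a * D m         ≈⟨ D+aD-closed m ⟩
    sgn m * (a * a' ^ m)        ≈⟨ *-congˡ (*-congʳ (*-identityʳ a)) ⟨
    sgn m * (a ^ 1 * a' ^ m)    ∎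
  minorDet-lower (suc m) c (suc d) (s≤s d+c≤m) = begin
    minorDet (suc (suc m)) (suc (suc (d ℕ.+ c))) c
      ≈⟨ minorDet-shiftRow m (suc (d ℕ.+ c)) c (s≤s (ℕₚ.m≤n+m c d)) (ℕₚ.≤-trans (ℕₚ.m≤n+m c d) d+c≤m) ⟩
    a * minorDet (suc m) (suc (d ℕ.+ c)) c         ≈⟨ *-congˡ (minorDet-lower m c d d+c≤m) ⟩
    a * (sgn (m ∸ d) * (a ^ suc d * a' ^ (m ∸ d)))
      ≈⟨ solve 4 (λ x s p q → x :* (s :* (p :* q)) := s :* ((x :* p) :* q)) refl a (sgn (m ∸ d)) (a ^ suc d) (a' ^ (m ∸ d)) ⟩
    sgn (m ∸ d) * (a ^ suc (suc d) * a' ^ (m ∸ d))  ∎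

  sgn-offDiagonal : ∀ d x n → d ℕ.≤ n → sgn (suc (d ℕ.+ x) ℕ.+ x) * sgn (n ∸ d) ≈ sgn (suc n)
  sgn-offDiagonal d x n d≤n = begin
    - sgn (d ℕ.+ x ℕ.+ x) * sgn (n ∸ d)
      ≈⟨ *-cong (-‿cong sgn-d+x+x) (sgn-∸ d≤n) ⟩
    - sgn d * (sgn n * sgn d)
      ≈⟨ -‿distribˡ-* _ _ ⟨
    - (sgn d * (sgn n * sgn d))
      ≈⟨ -‿cong (solve 2 (λ s t → s :* (t :* s) := t :* (s :* s)) refl (sgn d) (sgn n)) ⟩
    - (sgn n * (sgn d * sgn d))
      ≈⟨ -‿cong (trans (*-congˡ (sgn-*-sgn d)) (*-identityʳ _)) ⟩
    - sgn n ∎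
    where
    sgn-d+x+x : sgn (d ℕ.+ x ℕ.+ x) ≈ sgn d
    sgn-d+x+x = begin
      sgn (d ℕ.+ x ℕ.+ x)    ≡⟨ ≡.cong sgn (ℕₚ.+-assoc d x x) ⟩
      sgn (d ℕ.+ (x ℕ.+ x))  ≈⟨ sgn-+ d (x ℕ.+ x) ⟩
      sgn d * sgn (x ℕ.+ x)  ≈⟨ *-congˡ (sgn-double x) ⟩
      sgn d * 1#             ≈⟨ *-identityʳ _ ⟩
      sgn d                  ∎

  cofactor-K-upper : ∀ n x y → x ℕ.< y → y ℕ.≤ suc n →
                     sgn (x ℕ.+ y) * minorDet (suc n) x y ≈ sgn (suc n) * (a' ^ (y ∸ x) * a ^ (suc n ∸ (y ∸ x)))
  cofactor-K-upper n x y x<y y≤1+n with y ∸ suc x | ≡.trans (≡.sym (ℕₚ.+-suc (y ∸ suc x) x)) (ℕₚ.m∸n+n≡m x<y)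
  ... | d | ≡.refl rewrite ℕₚ.m+n∸n≡m (suc d) x = begin
    sgn (x ℕ.+ suc (d ℕ.+ x)) * minorDet (suc n) x (suc (d ℕ.+ x))
      ≈⟨ *-cong (reflexive (≡.cong sgn (ℕₚ.+-comm x (suc (d ℕ.+ x))))) (minorDet-upper n x d d+x≤n) ⟩
    sgn (suc (d ℕ.+ x) ℕ.+ x) * (sgn (n ∸ d) * (a' ^ suc d * a ^ (n ∸ d)))
      ≈⟨ *-assoc _ _ _ ⟨
    sgn (suc (d ℕ.+ x) ℕ.+ x) * sgn (n ∸ d) * (a' ^ suc d * a ^ (n ∸ d))
      ≈⟨ *-congʳ (sgn-offDiagonal d x n (ℕₚ.m+n≤o⇒m≤o d d+x≤n)) ⟩
    sgn (suc n) * (a' ^ suc d * a ^ (n ∸ d)) ∎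
    where d+x≤n = ℕₚ.≤-pred y≤1+n

  cofactor-K-lower : ∀ n x y → y ℕ.< x → x ℕ.≤ suc n →
                     sgn (x ℕ.+ y) * minorDet (suc n) x y ≈ sgn (suc n) * (a' ^ (suc n ∸ (x ∸ y)) * a ^ (x ∸ y))
  cofactor-K-lower n x y y<x x≤1+n with x ∸ suc y | ≡.trans (≡.sym (ℕₚ.+-suc (x ∸ suc y) y)) (ℕₚ.m∸n+n≡m y<x)
  ... | d | ≡.refl rewrite ℕₚ.m+n∸n≡m (suc d) y = begin
    sgn (suc (d ℕ.+ y) ℕ.+ y) * minorDet (suc n) (suc (d ℕ.+ y)) y
      ≈⟨ *-congˡ (minorDet-lower n y d d+y≤n) ⟩
    sgn (suc (d ℕ.+ y) ℕ.+ y) * (sgn (n ∸ d) * (a ^ suc d * a' ^ (n ∸ d)))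
      ≈⟨ *-assoc _ _ _ ⟨
    sgn (suc (d ℕ.+ y) ℕ.+ y) * sgn (n ∸ d) * (a ^ suc d * a' ^ (n ∸ d))
      ≈⟨ *-cong (sgn-offDiagonal d y n (ℕₚ.m+n≤o⇒m≤o d d+y≤n)) (*-comm _ _) ⟩
    sgn (suc n) * (a' ^ (n ∸ d) * a ^ suc d) ∎
    where d+y≤n = ℕₚ.≤-pred x≤1+n

  ones : ∀ {n} → Fin n → Carrier
  ones _ = 1#

  det-onesRow₀-suc : ∀ m → det (setRow (K (suc (suc m))) zero ones) ≈ - a' * det (setRow (K (suc m)) zero ones)
  det-onesRow₀-suc m = begin
    det M
      ≈⟨ det-rowReduce M {zero} {suc zero} (λ ()) a w rows ⟩
    ∑ (λ l → w l * cofactor M (suc zero) l)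
      ≈⟨ ∑-δ₂ (a' + - a) (- a) zero (suc zero) (cofactor M (suc zero)) ⟩
    (a' + - a) * cofactor M (suc zero) zero + - a * cofactor M (suc zero) (suc zero)
      ≈⟨ +-cong (*-congˡ (trans (-1*x≈-x _) (-‿cong (det-cong minor₁₀≈))))
                (*-congˡ (trans (cofactor-diagonal M (suc zero)) (det-cong minor₁₁≈))) ⟩
    (a' + - a) * - X + - a * X
      ≈⟨ solve 4 (λ p q X Y → (p :+ q) :* Y :+ q :* X := p :* Y :+ q :* (Y :+ X)) refl a' (- a) X (- X) ⟩
    a' * - X + - a * (- X + X)
      ≈⟨ +-congˡ (trans (*-congˡ (-‿inverseˡ X)) (zeroʳ _)) ⟩
    a' * - X + 0#
      ≈⟨ +-identityʳ _ ⟩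
    a' * - X
      ≈⟨ trans (sym (-‿distribˡ-* a' X)) (-‿distribʳ-* a' X) ⟨
    - a' * X ∎
    where
    M = setRow (K (suc (suc m))) zero ones
    X = det (setRow (K (suc m)) zero ones)
    w : Fin (suc (suc m)) → Carrier
    w l = (a' + - a) * δ zero l + - a * δ (suc zero) l
    rows : ∀ l → M (suc zero) l ≈ a * M zero l + w l
    rows zero = sym (begin
      a * 1# + ((a' + - a) * 1# + - a * 0#)
        ≈⟨ solve 3 (λ x y z → x :* con 1 :+ ((y :+ z) :* con 1 :+ z :* con 0) := y :+ (x :+ z)) refl a a' (- a) ⟩
      a' + (a + - a)                         ≈⟨ +-congˡ (-‿inverseʳ a) ⟩
      a' + 0#                                ≈⟨ +-identityʳ a' ⟩
      a'                                     ∎)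
    rows (suc zero) = sym (begin
      a * 1# + ((a' + - a) * 0# + - a * 1#)
        ≈⟨ solve 3 (λ x y z → x :* con 1 :+ ((y :+ z) :* con 0 :+ z :* con 1) := x :+ z) refl a a' (- a) ⟩
      a + - a                                ≈⟨ -‿inverseʳ a ⟩
      0#                                     ∎)
    rows (suc (suc _)) = sym (solve 3 (λ x y z → x :* con 1 :+ ((y :+ z) :* con 0 :+ z :* con 0) := x) refl a a' (- a))
    minor₁₀≈ : ∀ k l → minor (suc zero) zero M k l ≈ setRow (K (suc m)) zero ones k l
    minor₁₀≈ zero    l = refl
    minor₁₀≈ (suc k) l = refl
    minor₁₁≈ : ∀ k l → minor (suc zero) (suc zero) M k l ≈ setRow (K (suc m)) zero ones k l
    minor₁₁≈ zero    l       = refl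
    minor₁₁≈ (suc k) zero    = refl
    minor₁₁≈ (suc k) (suc l) = refl

  det-onesRow₀ : ∀ m → det (setRow (K (suc m)) zero ones) ≈ sgn m * a' ^ m
  det-onesRow₀ zero    = trans (+-identityʳ _) (*-identityˡ _)
  det-onesRow₀ (suc m) = begin
    det (setRow (K (suc (suc m))) zero ones)  ≈⟨ det-onesRow₀-suc m ⟩
    - a' * det (setRow (K (suc m)) zero ones)  ≈⟨ *-congˡ (det-onesRow₀ m) ⟩
    - a' * (sgn m * a' ^ m)                    ≈⟨ -x*[s*p]≈-s*[x*p] a' (sgn m) (a' ^ m) ⟩
    - sgn m * (a' * a' ^ m)                    ∎

  det-onesRow-suc : ∀ m i → det (setRow (K (suc (suc m))) (suc i) ones) ≈ - a * det (setRow (K (suc m)) i ones)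
  det-onesRow-suc m i = begin
    det M                                        ≈⟨ det-rowReduce M {suc i} {zero} (λ ()) a w rows ⟩
    ∑ (λ l → (- a * δ zero l) * cofactor M zero l)  ≈⟨ ∑-scaledδ (- a) zero (cofactor M zero) ⟩
    - a * cofactor M zero zero                   ≈⟨ *-congˡ (trans (cofactor-diagonal M zero)
                                                      (det-cong (minor₀₀-setRow (K (suc (suc m))) i ones))) ⟩
    - a * det (setRow (K (suc m)) i ones)        ∎
    where
    M = setRow (K (suc (suc m))) (suc i) ones
    w : Fin (suc (suc m)) → Carrier
    w l = - a * δ zero l
    row₀ : ∀ l → M zero l ≈ a * 1# + w l
    row₀ zero    = sym (trans (+-cong (*-identityʳ a) (*-identityʳ _)) (-‿inverseʳ a))
    row₀ (suc l) = sym (trans (+-cong (*-identityʳ a) (zeroʳ _)) (+-identityʳ a))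
    rows : ∀ l → M zero l ≈ a * M (suc i) l + w l
    rows l = trans (row₀ l) (+-congʳ (*-congˡ (sym (setRow-updates (K (suc (suc m))) (suc i) ones l))))

  ∑-det-onesRow : ∀ m → ∑ (λ i → det (setRow (K (suc m)) i ones)) ≈ sgn m * H a a' (suc m)
  ∑-det-onesRow zero    = solve 0 (con 1 :* (con 1 :* con 1) :+ con 0 :+ con 0 := con 1 :* (con 1 :* con 1 :+ con 0)) refl
  ∑-det-onesRow (suc m) = begin
    det (setRow (K (suc (suc m))) zero ones) + ∑ (λ i → det (setRow (K (suc (suc m))) (suc i) ones))
      ≈⟨ +-cong (det-onesRow₀ (suc m)) (∑-cong {f = λ i → det (setRow (K (suc (suc m))) (suc i) ones)}
                                               {g = λ i → - a * det (setRow (K (suc m)) i ones)} (det-onesRow-suc m)) ⟩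
    - sgn m * (a' * a' ^ m) + ∑ (λ i → - a * det (setRow (K (suc m)) i ones))
      ≈⟨ +-congˡ (*-distribˡ-∑ (- a) (λ i → det (setRow (K (suc m)) i ones))) ⟨
    - sgn m * (a' * a' ^ m) + - a * ∑ (λ i → det (setRow (K (suc m)) i ones))
      ≈⟨ +-congˡ (trans (*-congˡ (∑-det-onesRow m)) (-x*[s*p]≈-s*[x*p] a (sgn m) _)) ⟩
    - sgn m * (a' * a' ^ m) + - sgn m * (a * H a a' (suc m))
      ≈⟨ distribˡ _ _ _ ⟨
    - sgn m * (a' * a' ^ m + a * H a a' (suc m))
      ≈⟨ *-congˡ (H-suc (suc m)) ⟨
    - sgn m * H a a' (suc (suc m)) ∎

  cofactor-DK : ∀ {n} (i j : Fin (suc n)) → cofactor (DK (suc n) a a') i j ≈ cofactor (K (suc n)) i j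
  cofactor-DK {n} i j = *-congˡ (det-cong (λ k l → reflexive (DK≡entry (suc n) (punchIn i k) (punchIn j l))))

  det-DK : ∀ n → det (DK (suc n) a a') ≈ sgn n * (a * (a' * H a a' n))
  det-DK n = trans (det-cong (λ i j → reflexive (DK≡entry (suc n) i j))) (D-closed n)

  cof-DK : ∀ n → cof (DK (suc n) a a') ≈ sgn n * H a a' (suc n)
  cof-DK n = trans (∑-cong {f = λ i → ∑ (cofactor (DK (suc n) a a') i)} {g = λ i → det (setRow (K (suc n)) i ones)} (λ i →
                     trans (∑-cong {f = cofactor (DK (suc n) a a') i} {g = cofactor (K (suc n)) i} (cofactor-DK i))
                           (sym (trans (det-setRow (K (suc n)) i ones)
                                       (∑-cong {f = λ l → 1# * cofactor (K (suc n)) i l} (λ l → *-identityˡ _))))))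
                   (∑-det-onesRow n)

  adj-DK-diagonal : ∀ n (i : Fin (suc (suc n))) → adj (DK (suc (suc n)) a a') i i ≈ sgn (suc n) * - (a * (a' * H a a' n))
  adj-DK-diagonal n i = begin
    cofactor (DK (suc (suc n)) a a') i i  ≈⟨ cofactor-DK i i ⟩
    cofactor (K (suc (suc n))) i i        ≈⟨ cofactor-K-diagonal i ⟩
    D (suc n)                             ≈⟨ D-closed n ⟩
    sgn n * (a * (a' * H a a' n))         ≈⟨ -‿*-‿ _ _ ⟨
    - sgn n * - (a * (a' * H a a' n))     ∎

  adj-DK-lower : ∀ n (i j : Fin (suc (suc n))) → j < i →
                 adj (DK (suc (suc n)) a a') i j ≈ sgn (suc n) * (a' ^ (toℕ i ∸ toℕ j) * a ^ (suc n ∸ (toℕ i ∸ toℕ j)))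
  adj-DK-lower n i j j<i = trans (cofactor-DK j i)
    (trans (cofactor-K j i) (cofactor-K-upper n (toℕ j) (toℕ i) j<i (ℕₚ.≤-pred (Finₚ.toℕ<n i))))

  adj-DK-upper : ∀ n (i j : Fin (suc (suc n))) → i < j →
                 adj (DK (suc (suc n)) a a') i j ≈ sgn (suc n) * (a' ^ (suc n ∸ (toℕ j ∸ toℕ i)) * a ^ (toℕ j ∸ toℕ i))
  adj-DK-upper n i j i<j = trans (cofactor-DK j i)
    (trans (cofactor-K j i) (cofactor-K-lower n (toℕ j) (toℕ i) i<j (ℕₚ.≤-pred (Finₚ.toℕ<n j))))

  adj-DK₁ : ∀ (i j : Fin 1) → adj (DK 1 a a') i j ≈ 1#
  adj-DK₁ zero zero = *-identityˡ 1#

  cof-DK₁ : cof (DK 1 a a') ≈ 1#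
  cof-DK₁ = trans (+-identityʳ _) (trans (+-identityʳ _) (*-identityˡ 1#))

lemma2p16 : ∀ {c ℓ : Level} (R : CommutativeRing c ℓ) →
  let open CommutativeRing R
      open Det R
  in ∀ (a a' : Carrier) →
    -- det and cof for every p = n + 1 ≥ 1  (H a a' k denotes h_{k-1})
    (∀ (n : ℕ) →
      (det (DK (suc n) a a') ≈ sgn n * (a * (a' * H a a' n)))
      × (cof (DK (suc n) a a') ≈ sgn n * H a a' (suc n)))
    -- adjugate for p = n + 2 ≥ 2  (Toeplitz description)
    × (∀ (n : ℕ) (i j : Fin (suc (suc n))) →
        (i ≡ j → adj (DK (suc (suc n)) a a') i j
            ≈ sgn (suc n) * (- (a * (a' * H a a' n))))
        × (j < i → adj (DK (suc (suc n)) a a') i j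
            ≈ sgn (suc n) * ((a' ^ (toℕ i ∸ toℕ j)) * (a ^ (suc n ∸ (toℕ i ∸ toℕ j)))))
        × (i < j → adj (DK (suc (suc n)) a a') i j
            ≈ sgn (suc n) * ((a' ^ (suc n ∸ (toℕ j ∸ toℕ i))) * (a ^ (toℕ j ∸ toℕ i)))))
    -- p = 1
    × (∀ (i j : Fin 1) → adj (DK 1 a a') i j ≈ 1#)
    × (cof (DK 1 a a') ≈ 1#)
lemma2p16 R a a' =
    (λ n → det-DK n , cof-DK n)
  , (λ n i j → (λ { ≡.refl → adj-DK-diagonal n i }) , adj-DK-lower n i j , adj-DK-upper n i j)
  , adj-DK₁
  , cof-DK₁
  where open Toeplitz R a a'
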